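{- The set $\{(u,v)\in\mathbb{YF}^2:\ v \text{ is obtained from } u \text{ by deleting the maximal prefix of } u \text{ consisting of letters } 1\}$ is first-order definable in $\mathbf{YF}^*=\langle\mathbb{YF},\geqslant,2\rangle$.
   Context: $\mathbb{YF}$ is the set of all finite words (including the empty word $\varepsilon$) over $\{1,2\}$. For a word $v$, $\#v$ is its length and $d(v)$ the number of letters $2$. Order: write $x=x'w$, $y=y'w$ with $w$ the longest common suffix; then $y\geqslant x$ iff $d(y')\geqslant\#x'$. $\mathbf{YF}^*$ is this partial order with an added constant symbol interpreted as the word $2$. A relation is first-order definable if there is a first-order formula in the language $\{\geqslant,2\}$ whose set of satisfying tuples is exactly the relation. -}

module Defs where

open import Data.Nat using (ℕ; zero; suc; _+_; _≥_)
open import Data.List using (List; []; _∷_; reverse; length)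
open import Data.Product using (_×_; _,_; Σ; ∃)
open import Data.Fin using (Fin; zero; suc)
open import Data.Empty using (⊥)
open import Relation.Nullary using (¬_)
open import Relation.Binary.PropositionalEquality using (_≡_)

data Letter : Set where
  one two : Letter

-- YF: finite words over {1,2}; written left to right, the head of the list is
-- the first (leftmost) letter.
Word : Set
Word = List Letter

d : Word → ℕ
d []         = 0
d (one ∷ v)  = d v
d (two ∷ v)  = suc (d v)

dropCommonPrefix : Word → Word → Word × Word
dropCommonPrefix (one ∷ a) (one ∷ b) = dropCommonPrefix a b
dropCommonPrefix (two ∷ a) (two ∷ b) = dropCommonPrefix a b
dropCommonPrefix a b = a , b

stripSuffix : Word → Word → Word × Word
stripSuffix x y with dropCommonPrefix (reverse x) (reverse y)
... | (rx , ry) = reverse rx , reverse ry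

_≥Y_ : Word → Word → Set
y ≥Y x with stripSuffix x y
... | (x' , y') = d y' ≥ length x'

wordTwo : Word
wordTwo = two ∷ []

deleteLeading1s : Word → Word
deleteLeading1s (one ∷ u) = deleteLeading1s u
deleteLeading1s u = u

-- First-order logic (with equality) in the language {≥, 2}.
-- Variables are de Bruijn indices: Formula n has n free variables.

data Term (n : ℕ) : Set where
  var  : Fin n → Term n
  cTwo : Term n

data Formula : ℕ → Set where
  _≐_  : ∀ {n} → Term n → Term n → Formula n
  _⩾_  : ∀ {n} → Term n → Term n → Formula n
  ¬f_  : ∀ {n} → Formula n → Formula n
  _∧f_ : ∀ {n} → Formula n → Formula n → Formula n
  ∃f_  : ∀ {n} → Formula (suc n) → Formula n

Env : ℕ → Set
Env n = Fin n → Word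

extend : ∀ {n} → Word → Env n → Env (suc n)
extend w ρ zero    = w
extend w ρ (suc i) = ρ i

evalT : ∀ {n} → Env n → Term n → Word
evalT ρ (var i) = ρ i
evalT ρ cTwo    = wordTwo

Sat : ∀ {n} → Env n → Formula n → Set
Sat ρ (s ≐ t)   = evalT ρ s ≡ evalT ρ t
Sat ρ (s ⩾ t)   = evalT ρ s ≥Y evalT ρ t
Sat ρ (¬f φ)    = ¬ Sat ρ φ
Sat ρ (φ ∧f ψ)  = Sat ρ φ × Sat ρ ψ
Sat ρ (∃f φ)    = Σ Word λ w → Sat (extend w ρ) φ

env2 : Word → Word → Env 2
env2 u v zero    = u
env2 u v (suc _) = v

Definable2 : (Word → Word → Set) → Set
Definable2 R = Σ (Formula 2) λ φ → ∀ u v →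
  (Sat (env2 u v) φ → R u v) × (R u v → Sat (env2 u v) φ)

-- Read on reversed words, x ≤ y compares what remains after the longest common
-- prefix.  In this order one ∷ y covers y, and everything strictly below one ∷ y
-- lies below y, so a word starting with 1 has a greatest element strictly below
-- it.  Among the other words only 2 has one: [] is minimal, and for z ≠ [] no
-- word lies strictly between one ∷ z and two ∷ z (the order strictly increases
-- the weight length + #2s, and their weights differ by one), while some word
-- below two ∷ z is incomparable with one ∷ z.  Hence "starts with 1" is
-- definable, and deleteLeading1s u, being the greatest word ≤ u not starting
-- with 1, is the unique maximal element of that definable set.
module Submission where

open import Defs
open import Data.Nat using (ℕ; suc; _+_; _≤_; _<_; z≤n; s≤s; _≤?_)
open import Data.Nat.Properties
  using (≤-trans; +-mono-≤; +-suc; +-identityʳ; +-comm; <-asym; <⇒≱; n≮0; ≤-pred; n≤1+n)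
open import Data.List using ([]; _∷_; reverse; length; _++_; _∷ʳ_)
open import Data.List.Properties
  using (≡-dec; unfold-reverse; reverse-++; length-reverse; reverse-injective; ++-cancelʳ)
open import Data.Product using (_×_; _,_; ∃; proj₁; proj₂)
open import Data.Sum using (_⊎_; inj₁; inj₂)
open import Data.Fin using (Fin; zero; suc)
open import Data.Empty using (⊥; ⊥-elim)
open import Function.Base using (_∘_)
open import Function.Bundles using (_⇔_; mk⇔; Equivalence)
open import Relation.Nullary using (¬_; Dec; yes; no; contradiction)
open import Relation.Binary.PropositionalEquality
  using (_≡_; _≢_; refl; sym; trans; cong; cong₂; subst; subst₂)
open Relation.Binary.PropositionalEquality.≡-Reasoning

infix 4 _≟ₗ_ _≟_ _≤Y_ _<Y_ _≤Y?_ _⊑_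

_≟ₗ_ : (a b : Letter) → Dec (a ≡ b)
one ≟ₗ one = yes refl
one ≟ₗ two = no λ ()
two ≟ₗ one = no λ ()
two ≟ₗ two = yes refl

_≟_ : (x y : Word) → Dec (x ≡ y)
_≟_ = ≡-dec _≟ₗ_

_≤Y_ : Word → Word → Set
x ≤Y y = y ≥Y x

_<Y_ : Word → Word → Set
x <Y y = x ≤Y y × x ≢ y

_≤Y?_ : (x y : Word) → Dec (x ≤Y y)
x ≤Y? y = _ ≤? _

_⊑_ : Word → Word → Set
a ⊑ b = length (proj₁ (dropCommonPrefix a b)) ≤ d (proj₂ (dropCommonPrefix a b))

d-++ : ∀ xs ys → d (xs ++ ys) ≡ d xs + d ys
d-++ []         ys = refl
d-++ (one ∷ xs) ys = d-++ xs ys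
d-++ (two ∷ xs) ys = cong suc (d-++ xs ys)

d-reverse : ∀ w → d (reverse w) ≡ d w
d-reverse []      = refl
d-reverse (c ∷ w) = begin
  d (reverse (c ∷ w))        ≡⟨ cong d (unfold-reverse c w) ⟩
  d (reverse w ++ c ∷ [])    ≡⟨ d-++ (reverse w) (c ∷ []) ⟩
  d (reverse w) + d (c ∷ []) ≡⟨ cong (_+ d (c ∷ [])) (d-reverse w) ⟩
  d w + d (c ∷ [])           ≡⟨ +-comm (d w) (d (c ∷ [])) ⟩
  d (c ∷ []) + d w           ≡⟨ d-∷ c ⟩
  d (c ∷ w)                  ∎
  where
  d-∷ : ∀ c → d (c ∷ []) + d w ≡ d (c ∷ w)
  d-∷ one = refl
  d-∷ two = refl

d≤length : ∀ w → d w ≤ length w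
d≤length []        = z≤n
d≤length (one ∷ w) = ≤-trans (d≤length w) (n≤1+n _)
d≤length (two ∷ w) = s≤s (d≤length w)

≤Y⇒reverse⊑ : ∀ x y → x ≤Y y → reverse x ⊑ reverse y
≤Y⇒reverse⊑ x y = subst₂ _≤_ (length-reverse a) (d-reverse b)
  where
  a b : Word
  a = proj₁ (dropCommonPrefix (reverse x) (reverse y))
  b = proj₂ (dropCommonPrefix (reverse x) (reverse y))

reverse⊑⇒≤Y : ∀ x y → reverse x ⊑ reverse y → x ≤Y y
reverse⊑⇒≤Y x y = subst₂ _≤_ (sym (length-reverse a)) (sym (d-reverse b))
  where
  a b : Word
  a = proj₁ (dropCommonPrefix (reverse x) (reverse y))
  b = proj₂ (dropCommonPrefix (reverse x) (reverse y))

⊑-refl : ∀ a → a ⊑ a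
⊑-refl []        = z≤n
⊑-refl (one ∷ a) = ⊑-refl a
⊑-refl (two ∷ a) = ⊑-refl a

≤Y-refl : ∀ x → x ≤Y x
≤Y-refl x = reverse⊑⇒≤Y x x (⊑-refl (reverse x))

dropCommonPrefix-++ : ∀ r a b → dropCommonPrefix (r ++ a) (r ++ b) ≡ dropCommonPrefix a b
dropCommonPrefix-++ []        a b = refl
dropCommonPrefix-++ (one ∷ r) a b = dropCommonPrefix-++ r a b
dropCommonPrefix-++ (two ∷ r) a b = dropCommonPrefix-++ r a b

⊑-++ˡ⁺ : ∀ r a b → a ⊑ b → r ++ a ⊑ r ++ b
⊑-++ˡ⁺ r a b a⊑b rewrite dropCommonPrefix-++ r a b = a⊑b

⊑-++ˡ⁻ : ∀ r a b → r ++ a ⊑ r ++ b → a ⊑ b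
⊑-++ˡ⁻ r a b ra⊑rb rewrite dropCommonPrefix-++ r a b = ra⊑rb

≤Y-++ʳ⁺ : ∀ x y w → x ≤Y y → x ++ w ≤Y y ++ w
≤Y-++ʳ⁺ x y w x≤y = reverse⊑⇒≤Y (x ++ w) (y ++ w)
  (subst₂ _⊑_ (sym (reverse-++ x w)) (sym (reverse-++ y w))
    (⊑-++ˡ⁺ (reverse w) (reverse x) (reverse y) (≤Y⇒reverse⊑ x y x≤y)))

≤Y-++ʳ⁻ : ∀ x y w → x ++ w ≤Y y ++ w → x ≤Y y
≤Y-++ʳ⁻ x y w xw≤yw = reverse⊑⇒≤Y x y
  (⊑-++ˡ⁻ (reverse w) (reverse x) (reverse y)
    (subst₂ _⊑_ (reverse-++ x w) (reverse-++ y w) (≤Y⇒reverse⊑ (x ++ w) (y ++ w) xw≤yw)))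

<Y-++ʳ⁺ : ∀ {x y} w → x <Y y → x ++ w <Y y ++ w
<Y-++ʳ⁺ {x} {y} w (x≤y , x≢y) = ≤Y-++ʳ⁺ x y w x≤y , λ e → x≢y (++-cancelʳ w x y e)

d-∷ʳ-one : ∀ b → d (b ∷ʳ one) ≡ d b
d-∷ʳ-one b = trans (d-++ b (one ∷ [])) (+-identityʳ (d b))

⊑[]⇒≡[] : ∀ {a} → a ⊑ [] → a ≡ []
⊑[]⇒≡[] {[]}      _  = refl
⊑[]⇒≡[] {one ∷ _} ()
⊑[]⇒≡[] {two ∷ _} ()

⊑-∷ʳ-one⁺ : ∀ a b → a ⊑ b → a ⊑ b ∷ʳ one
⊑-∷ʳ-one⁺ []        b         _ = z≤n
⊑-∷ʳ-one⁺ (one ∷ a) (one ∷ b) p = ⊑-∷ʳ-one⁺ a b p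
⊑-∷ʳ-one⁺ (two ∷ a) (two ∷ b) p = ⊑-∷ʳ-one⁺ a b p
⊑-∷ʳ-one⁺ (one ∷ a) (two ∷ b) p = subst (λ k → suc (length a) ≤ suc k) (sym (d-∷ʳ-one b)) p
⊑-∷ʳ-one⁺ (two ∷ a) (one ∷ b) p = subst (λ k → suc (length a) ≤ k) (sym (d-∷ʳ-one b)) p

⊑-∷ʳ-one⁻ : ∀ a b → a ⊑ b ∷ʳ one → a ≢ b ∷ʳ one → a ⊑ b
⊑-∷ʳ-one⁻ []        b         _ _   = z≤n
⊑-∷ʳ-one⁻ (one ∷ a) []        p a≢b = contradiction (cong (one ∷_) (⊑[]⇒≡[] p)) a≢b
⊑-∷ʳ-one⁻ (one ∷ a) (one ∷ b) p a≢b = ⊑-∷ʳ-one⁻ a b p (λ e → a≢b (cong (one ∷_) e))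
⊑-∷ʳ-one⁻ (two ∷ a) (two ∷ b) p a≢b = ⊑-∷ʳ-one⁻ a b p (λ e → a≢b (cong (two ∷_) e))
⊑-∷ʳ-one⁻ (one ∷ a) (two ∷ b) p _   = subst (λ k → suc (length a) ≤ suc k) (d-∷ʳ-one b) p
⊑-∷ʳ-one⁻ (two ∷ a) (one ∷ b) p _   = subst (λ k → suc (length a) ≤ k) (d-∷ʳ-one b) p

≤Y-one∷⁺ : ∀ x y → x ≤Y y → x ≤Y one ∷ y
≤Y-one∷⁺ x y x≤y = reverse⊑⇒≤Y x (one ∷ y)
  (subst (reverse x ⊑_) (sym (unfold-reverse one y))
    (⊑-∷ʳ-one⁺ (reverse x) (reverse y) (≤Y⇒reverse⊑ x y x≤y)))

≤Y-one∷⁻ : ∀ x y → x ≤Y one ∷ y → x ≢ one ∷ y → x ≤Y y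
≤Y-one∷⁻ x y x≤1y x≢1y = reverse⊑⇒≤Y x y
  (⊑-∷ʳ-one⁻ (reverse x) (reverse y)
    (subst (reverse x ⊑_) (unfold-reverse one y) (≤Y⇒reverse⊑ x (one ∷ y) x≤1y))
    (λ e → x≢1y (reverse-injective (trans e (sym (unfold-reverse one y))))))

weight : Word → ℕ
weight []        = 0
weight (one ∷ w) = suc (weight w)
weight (two ∷ w) = suc (suc (weight w))

weight≡length+d : ∀ w → weight w ≡ length w + d w
weight≡length+d []        = refl
weight≡length+d (one ∷ w) = cong suc (weight≡length+d w)
weight≡length+d (two ∷ w) = cong suc (trans (cong suc (weight≡length+d w)) (sym (+-suc (length w) (d w))))

weight-reverse : ∀ w → weight (reverse w) ≡ weight w
weight-reverse w = begin
  weight (reverse w)                  ≡⟨ weight≡length+d (reverse w) ⟩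
  length (reverse w) + d (reverse w)  ≡⟨ cong₂ _+_ (length-reverse w) (d-reverse w) ⟩
  length w + d w                      ≡⟨ weight≡length+d w ⟨
  weight w                            ∎

length≤d⇒weight≤ : ∀ a b → length a ≤ d b → weight a ≤ weight b
length≤d⇒weight≤ a b a≤b = subst₂ _≤_ (sym (weight≡length+d a)) (sym (weight≡length+d b))
  (+-mono-≤ (≤-trans a≤b (d≤length b)) (≤-trans (d≤length a) a≤b))

⊑⇒weight< : ∀ a b → a ⊑ b → a ≢ b → weight a < weight b
⊑⇒weight< []        []        _ a≢b = contradiction refl a≢b
⊑⇒weight< []        (one ∷ b) _ _   = s≤s z≤n
⊑⇒weight< []        (two ∷ b) _ _   = s≤s z≤n
⊑⇒weight< (one ∷ a) (one ∷ b) p a≢b = s≤s (⊑⇒weight< a b p (λ e → a≢b (cong (one ∷_) e)))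
⊑⇒weight< (two ∷ a) (two ∷ b) p a≢b = s≤s (s≤s (⊑⇒weight< a b p (λ e → a≢b (cong (two ∷_) e))))
⊑⇒weight< (one ∷ a) (two ∷ b) p _   = s≤s (s≤s (length≤d⇒weight≤ a b (≤-pred p)))
⊑⇒weight< (two ∷ a) (one ∷ b) p _   = s≤s (length≤d⇒weight≤ (two ∷ a) b p)

<Y⇒weight< : ∀ {x y} → x <Y y → weight x < weight y
<Y⇒weight< {x} {y} (x≤y , x≢y) = subst₂ _<_ (weight-reverse x) (weight-reverse y)
  (⊑⇒weight< (reverse x) (reverse y) (≤Y⇒reverse⊑ x y x≤y) (λ e → x≢y (reverse-injective e)))

<Y⇒≱Y : ∀ {x y} → x <Y y → ¬ y ≤Y x
<Y⇒≱Y {x} {y} x<y y≤x with y ≟ x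
... | yes refl = proj₂ x<y refl
... | no y≢x   = <-asym (<Y⇒weight< x<y) (<Y⇒weight< (y≤x , y≢x))

≮Y[] : ∀ {x} → ¬ x <Y []
≮Y[] x<[] = n≮0 (<Y⇒weight< x<[])

one∷-two∷-adjacent : ∀ {m} z → one ∷ z <Y m → m <Y two ∷ z → ⊥
one∷-two∷-adjacent z 1z<m m<2z = <⇒≱ (<Y⇒weight< 1z<m) (≤-pred (<Y⇒weight< m<2z))

below-two∷-incomparable-one∷ : ∀ z → z ≢ [] → ∃ λ w → w <Y two ∷ z × ¬ w ≤Y one ∷ z
below-two∷-incomparable-one∷ []        z≢[] = contradiction refl z≢[]
below-two∷-incomparable-one∷ (one ∷ y) _    =
  two ∷ y ,
  <Y-++ʳ⁺ {two ∷ []} {two ∷ one ∷ []} y (s≤s z≤n , λ ()) ,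
  λ w≤1z → contradiction (≤Y-++ʳ⁻ (two ∷ []) (one ∷ one ∷ []) y w≤1z) λ ()
below-two∷-incomparable-one∷ (two ∷ y) _    =
  two ∷ one ∷ y ,
  <Y-++ʳ⁺ {two ∷ one ∷ []} {two ∷ two ∷ []} y (s≤s (s≤s z≤n) , λ ()) ,
  λ w≤1z → contradiction (≤Y-++ʳ⁻ (two ∷ one ∷ []) (one ∷ two ∷ []) y w≤1z) λ { (s≤s ()) }

HasMaxBelow : Word → Set
HasMaxBelow x = ∃ λ m → m <Y x × ¬ (∃ λ t → t <Y x × ¬ t ≤Y m)

StartsWithOne : Word → Set
StartsWithOne x = ∃ λ y → x ≡ one ∷ y

hasMaxBelow-one∷ : ∀ y → HasMaxBelow (one ∷ y)
hasMaxBelow-one∷ y =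
  y , <Y-++ʳ⁺ {[]} {one ∷ []} y (z≤n , λ ()) ,
  λ { (t , (t≤1y , t≢1y) , t≰y) → t≰y (≤Y-one∷⁻ t y t≤1y t≢1y) }

¬hasMaxBelow-two∷ : ∀ z → z ≢ [] → ¬ HasMaxBelow (two ∷ z)
¬hasMaxBelow-two∷ z z≢[] (m , m<2z , noneAbove) =
  let w , w<2z , w≰1z = below-two∷-incomparable-one∷ z z≢[]
  in  w≰1z (subst (w ≤Y_) m≡1z (below⇒≤m w<2z))
  where
  below⇒≤m : ∀ {t} → t <Y two ∷ z → t ≤Y m
  below⇒≤m {t} t<2z with t ≤Y? m
  ... | yes t≤m = t≤m
  ... | no  t≰m = contradiction (t , t<2z , t≰m) noneAbove

  m≡1z : m ≡ one ∷ z
  m≡1z with m ≟ one ∷ z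
  ... | yes m≡1z = m≡1z
  ... | no  m≢1z = ⊥-elim (one∷-two∷-adjacent z (below⇒≤m 1z<2z , λ e → m≢1z (sym e)) m<2z)
    where
    1z<2z : one ∷ z <Y two ∷ z
    1z<2z = <Y-++ʳ⁺ {one ∷ []} {two ∷ []} z (s≤s z≤n , λ ())

hasMaxBelow⇒≡two⊎startsWithOne : ∀ x → HasMaxBelow x → x ≡ wordTwo ⊎ StartsWithOne x
hasMaxBelow⇒≡two⊎startsWithOne []            (_ , m<[] , _) = ⊥-elim (≮Y[] m<[])
hasMaxBelow⇒≡two⊎startsWithOne (one ∷ y)     _              = inj₂ (y , refl)
hasMaxBelow⇒≡two⊎startsWithOne (two ∷ [])    _              = inj₁ refl
hasMaxBelow⇒≡two⊎startsWithOne (two ∷ c ∷ z) h              = ⊥-elim (¬hasMaxBelow-two∷ (c ∷ z) (λ ()) h)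

startsWithOne⇔hasMaxBelow×≢two : ∀ x → StartsWithOne x ⇔ (HasMaxBelow x × x ≢ wordTwo)
startsWithOne⇔hasMaxBelow×≢two x = mk⇔ to from
  where
  to : StartsWithOne x → HasMaxBelow x × x ≢ wordTwo
  to (y , refl) = hasMaxBelow-one∷ y , λ ()
  from : HasMaxBelow x × x ≢ wordTwo → StartsWithOne x
  from (h , x≢2) with hasMaxBelow⇒≡two⊎startsWithOne x h
  ... | inj₁ x≡2 = contradiction x≡2 x≢2
  ... | inj₂ s   = s

IsGreatest : (Word → Set) → Word → Set
IsGreatest S g = S g × (∀ t → S t → t ≤Y g)

IsMaximal : (Word → Set) → Word → Set
IsMaximal S v = S v × ¬ (∃ λ x → v <Y x × S x)

greatest⇒maximal : ∀ {S g} → IsGreatest S g → IsMaximal S g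
greatest⇒maximal (Sg , ≤g) = Sg , λ { (x , g<x , Sx) → <Y⇒≱Y g<x (≤g x Sx) }

maximal⇒≡greatest : ∀ {S g v} → IsGreatest S g → IsMaximal S v → v ≡ g
maximal⇒≡greatest {g = g} {v} (Sg , ≤g) (Sv , noneAbove) with v ≟ g
... | yes v≡g = v≡g
... | no  v≢g = contradiction (g , (≤g v Sv , v≢g) , Sg) noneAbove

deleteLeading1s-≤Y : ∀ u → deleteLeading1s u ≤Y u
deleteLeading1s-≤Y []        = ≤Y-refl []
deleteLeading1s-≤Y (one ∷ u) = ≤Y-one∷⁺ (deleteLeading1s u) u (deleteLeading1s-≤Y u)
deleteLeading1s-≤Y (two ∷ u) = ≤Y-refl (two ∷ u)

¬startsWithOne-deleteLeading1s : ∀ u → ¬ StartsWithOne (deleteLeading1s u)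
¬startsWithOne-deleteLeading1s []        (_ , ())
¬startsWithOne-deleteLeading1s (one ∷ u) = ¬startsWithOne-deleteLeading1s u
¬startsWithOne-deleteLeading1s (two ∷ u) (_ , ())

≤Y-deleteLeading1s : ∀ u t → t ≤Y u → ¬ StartsWithOne t → t ≤Y deleteLeading1s u
≤Y-deleteLeading1s []        t t≤u _  = t≤u
≤Y-deleteLeading1s (one ∷ u) t t≤u ¬s = ≤Y-deleteLeading1s u t (≤Y-one∷⁻ t u t≤u λ e → ¬s (u , e)) ¬s
≤Y-deleteLeading1s (two ∷ u) t t≤u _  = t≤u

deleteLeading1s-isGreatest : ∀ u → IsGreatest (λ t → t ≤Y u × ¬ StartsWithOne t) (deleteLeading1s u)
deleteLeading1s-isGreatest u =
  (deleteLeading1s-≤Y u , ¬startsWithOne-deleteLeading1s u) ,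
  λ { t (t≤u , ¬s) → ≤Y-deleteLeading1s u t t≤u ¬s }

infix 4 _≼ᶠ_ _≺ᶠ_

_≼ᶠ_ : ∀ {n} → Term n → Term n → Formula n
s ≼ᶠ t = t ⩾ s

_≺ᶠ_ : ∀ {n} → Term n → Term n → Formula n
s ≺ᶠ t = (s ≼ᶠ t) ∧f (¬f (s ≐ t))

hasMaxBelowᶠ : ∀ {n} → Fin n → Formula n
hasMaxBelowᶠ i =
  ∃f ((var zero ≺ᶠ var (suc i)) ∧f
      (¬f (∃f ((var zero ≺ᶠ var (suc (suc i))) ∧f (¬f (var zero ≼ᶠ var (suc zero)))))))

startsWithOneᶠ : ∀ {n} → Fin n → Formula n
startsWithOneᶠ i = hasMaxBelowᶠ i ∧f (¬f (var i ≐ cTwo))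

deleteLeading1sᶠ : Formula 2
deleteLeading1sᶠ =
  ((v ≼ᶠ u) ∧f (¬f (startsWithOneᶠ (suc zero)))) ∧f
  (¬f (∃f ((var (suc (suc zero)) ≺ᶠ var zero) ∧f
           ((var zero ≼ᶠ var (suc zero)) ∧f (¬f (startsWithOneᶠ zero))))))
  where
  u v : Term 2
  u = var zero
  v = var (suc zero)

mainTheorem18 : Definable2 (λ u v → v ≡ deleteLeading1s u)
mainTheorem18 = deleteLeading1sᶠ , λ u v →
  maximal⇒≡greatest (greatest u) , λ { refl → greatest⇒maximal (greatest u) }
  where
  greatest : ∀ u → IsGreatest (λ t → t ≤Y u × ¬ (HasMaxBelow t × t ≢ wordTwo)) (deleteLeading1s u)
  greatest u =
    let (dl≤u , ¬s-dl) , ≤dl = deleteLeading1s-isGreatest u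
    in  (dl≤u , ¬s-dl ∘ from (startsWithOne⇔hasMaxBelow×≢two _)) ,
        λ { t (t≤u , ¬h) → ≤dl t (t≤u , ¬h ∘ to (startsWithOne⇔hasMaxBelow×≢two t)) }
    where open Equivalence using (to; from)
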